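{- For $n\geq 5$ and $\alpha\in\{231,312\}$, the number $i_n(\emptyset;\alpha)$ of involutions of $\{1,\dots,n\}$ containing the pattern $\alpha$ exactly once equals $(n-1)2^{n-6}$.
   Context: An involution is a permutation with $\pi^{ -1}=\pi$. An occurrence of a pattern $\alpha\in S_m$ in $\pi\in S_n$ (one-line notation) is a set of indices $i_1<\dots<i_m$ such that $\pi_{i_1}\cdots\pi_{i_m}$ is order-isomorphic to $\alpha$; $\pi$ contains $\alpha$ exactly once if there is exactly one such occurrence. -}

module Defs where

open import Data.Nat using (ℕ; zero; suc)
open import Data.Bool using (Bool)
open import Data.Bool.Properties using () renaming (_≟_ to _≟ᵇ_)
open import Data.Fin using (Fin; zero; suc; _<_; _<?_)
open import Data.Fin.Properties using (all?) renaming (_≟_ to _≟ᶠ_)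
open import Data.Vec using (Vec; []; _∷_; lookup)
open import Data.List using (List; []; _∷_; concatMap; map; filter; length; allFin)
open import Relation.Nullary using (Dec)
open import Relation.Nullary.Decidable using (isYes; _×-dec_)
open import Relation.Binary.PropositionalEquality using (_≡_)
open import Data.Product using (_×_; _,_)

-- Permutations of {1..n} are encoded 0-based in one-line notation as
-- vectors π : Vec (Fin n) n, with π_i = lookup π i.

allVecs : {A : Set} → List A → (m : ℕ) → List (Vec A m)
allVecs xs zero = [] ∷ []
allVecs xs (suc m) = concatMap (λ x → map (x ∷_) (allVecs xs m)) xs

-- π is an involution: π (π i) = i for all i (this forces π to be a bijection)
IsInvolution : ∀ {n} → Vec (Fin n) n → Set
IsInvolution {n} π = ∀ (i : Fin n) → lookup π (lookup π i) ≡ i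

isInvolution? : ∀ {n} (π : Vec (Fin n) n) → Dec (IsInvolution π)
isInvolution? π = all? (λ i → lookup π (lookup π i) ≟ᶠ i)

OrderIso : ∀ {n} → Vec (Fin n) 3 → Vec (Fin 3) 3 → Set
OrderIso x α = ∀ (a b : Fin 3) →
  isYes (lookup x a <? lookup x b) ≡ isYes (lookup α a <? lookup α b)

orderIso? : ∀ {n} (x : Vec (Fin n) 3) (α : Vec (Fin 3) 3) → Dec (OrderIso x α)
orderIso? x α = all? (λ a → all? (λ b →
  isYes (lookup x a <? lookup x b) ≟ᵇ isYes (lookup α a <? lookup α b)))

triples : (n : ℕ) → List (Fin n × Fin n × Fin n)
triples n = concatMap (λ i → concatMap (λ j → map (λ k → (i , j , k)) (allFin n)) (allFin n)) (allFin n)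

IsOccurrence : ∀ {n} → Vec (Fin n) n → Vec (Fin 3) 3 → Fin n × Fin n × Fin n → Set
IsOccurrence π α (i , j , k) =
  (i < j) × (j < k) × OrderIso (lookup π i ∷ lookup π j ∷ lookup π k ∷ []) α

isOccurrence? : ∀ {n} (π : Vec (Fin n) n) (α : Vec (Fin 3) 3) t → Dec (IsOccurrence π α t)
isOccurrence? π α (i , j , k) =
  (i <? j) ×-dec ((j <? k) ×-dec orderIso? (lookup π i ∷ lookup π j ∷ lookup π k ∷ []) α)

occurrences : ∀ {n} → Vec (Fin n) n → Vec (Fin 3) 3 → ℕ
occurrences {n} π α = length (filter (isOccurrence? π α) (triples n))

InvolutionContainingOnce : ∀ {n} → Vec (Fin 3) 3 → Vec (Fin n) n → Set
InvolutionContainingOnce α π = IsInvolution π × occurrences π α ≡ 1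

involutionContainingOnce? : ∀ {n} (α : Vec (Fin 3) 3) (π : Vec (Fin n) n) →
  Dec (InvolutionContainingOnce α π)
involutionContainingOnce? α π = isInvolution? π ×-dec (occurrences π α Data.Nat.≟ 1)

iInv : (n : ℕ) → Vec (Fin 3) 3 → ℕ
iInv n α = length (filter (involutionContainingOnce? α) (allVecs (allFin n) n))

-- the patterns 231 and 312, 0-based
p231 : Vec (Fin 3) 3
p231 = suc zero ∷ suc (suc zero) ∷ zero ∷ []

p312 : Vec (Fin 3) 3
p312 = suc (suc zero) ∷ zero ∷ suc zero ∷ []

-- Let π be an involution of {0, …, n-1} and c = π 0, so that π c = 0. If no occurrence of 231
-- ends at position c, then π is decreasing on [0, c], since an ascent p < q ≤ c would make
-- (p, q, c) an occurrence. So π is the direct sum of the descending block c, …, 0 and an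
-- involution of the remaining points, and the descending block neither creates nor destroys
-- occurrences. Hence the numbers a_m of 231-avoiding involutions satisfy a_{m+1} = Σ_{k ≤ m} a_k,
-- that is a_{m+1} = 2^m. If π contains 231 exactly once, either the occurrence does not end at c,
-- and π is a descending block followed by an involution containing 231 once, or it does, and
-- then π is 3 1 2 0 followed by a 231-avoiding involution, since any other shape of the first
-- block yields a second occurrence. Thus i_n = Σ_{k < n} i_k + a_{n-4}, solved by (n - 1) 2^(n-6).
-- Exchanging positions and values turns the occurrences of 231 in an involution into those of
-- 231⁻¹ = 312, so the count for 312 is the same.

module Submission where

open import Defs
open import Data.Bool using (T)
open import Data.Empty using (⊥-elim)
open import Data.Fin using (Fin; zero; suc; toℕ; fromℕ<; _<?_) renaming (_<_ to _<ᶠ_)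
import Data.Fin.Properties as Fin
open import Data.Fin.Properties using (toℕ-injective; toℕ<n; toℕ-fromℕ<)
open import Data.List using (List; []; _∷_; _++_; map; concatMap; filter; length; drop; downFrom; allFin)
import Data.List.Properties as List
open import Data.List.Properties
  using (length-++; length-map; length-drop; length-downFrom; ++-cancelˡ; map-injective)
open import Data.List.Membership.Propositional using (_∈_; lose; find)
open import Data.List.Membership.Propositional.Properties
  using ( ∈-++⁺ˡ; ∈-++⁺ʳ; ∈-++⁻; ∈-map⁺; ∈-map⁻; ∈-filter⁺; ∈-filter⁻
        ; ∈-concatMap⁺; ∈-concatMap⁻; ∈-allFin)
open import Data.List.Membership.Propositional.Properties.WithK using (unique∧set⇒bag)
open import Data.List.Relation.Binary.BagAndSetEquality using (∼bag⇒↭)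
open import Data.List.Relation.Binary.Permutation.Propositional.Properties using (↭-length)
open import Data.List.Relation.Unary.All using ([])
import Data.List.Relation.Unary.All as All
import Data.List.Relation.Unary.All.Properties as All
open import Data.List.Relation.Unary.AllPairs using ([]; _∷_)
import Data.List.Relation.Unary.AllPairs as AllPairs
import Data.List.Relation.Unary.AllPairs.Properties as AllPairs
open import Data.List.Relation.Unary.Any using (here)
open import Data.List.Relation.Binary.Disjoint.Propositional using (Disjoint)
open import Data.List.Relation.Unary.Unique.Propositional using (Unique)
import Data.List.Relation.Unary.Unique.Propositional.Properties as Unique
open import Data.Nat using (ℕ; zero; suc; _+_; _*_; _^_; _∸_; _≤_; _<_; s≤s; z≤n)
open import Data.Nat.Induction using (<-rec)
open import Data.Nat.Properties hiding (_<?_)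
open import Data.Nat.Solver using (module +-*-Solver)
open import Data.Product using (Σ; ∃-syntax; ∃!; _×_; _,_; proj₁; proj₂)
open import Data.Sum using (_⊎_; inj₁; inj₂; [_,_]′)
open import Data.Vec using (Vec; []; _∷_; lookup; head; tabulate)
open import Data.Vec.Properties using (∷-injectiveʳ; lookup∘tabulate)
open import Function using (id; _∘_; _∘′_; Injective)
open import Function.Bundles using (_⇔_; mk⇔; Equivalence)
import Function.Properties.Equivalence as ⇔
open import Relation.Binary using (tri<; tri≈; tri>)
open import Relation.Binary.PropositionalEquality
open import Relation.Nullary using (¬_; Dec; yes; no)
open import Relation.Nullary.Decidable using (isYes; isYes≗does; does-⇔; toWitness; fromWitness)
open import Relation.Unary using (Decidable; _⊆_; _∪_)

-- Finite enumerations

private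
  variable
    A B : Set
    P Q : A → Set
    k₁ k₂ : ℕ

record Enumeration {A : Set} (P : A → Set) (k : ℕ) : Set where
  constructor enumeration
  field
    elements : List A
    distinct : Unique elements
    sound    : ∀ {z} → z ∈ elements → P z
    complete : ∀ {z} → P z → z ∈ elements
    size     : length elements ≡ k

enumeration-size-unique : Enumeration P k₁ → Enumeration P k₂ → k₁ ≡ k₂
enumeration-size-unique (enumeration xs u s c refl) (enumeration ys u' s' c' refl) =
  ↭-length (∼bag⇒↭ (unique∧set⇒bag u u' (mk⇔ (c' ∘′ s) (c ∘′ s'))))

enumeration-resp : P ⊆ Q → Q ⊆ P → Enumeration P k₁ → Enumeration Q k₁
enumeration-resp P⊆Q Q⊆P (enumeration xs u s c e) = enumeration xs u (P⊆Q ∘ s) (c ∘ Q⊆P) e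

enumeration-empty : (∀ z → ¬ P z) → Enumeration P 0
enumeration-empty ¬P = enumeration [] [] (λ ()) (λ {z} p → ⊥-elim (¬P z p)) refl

enumeration-∪ : ∀ {a b} → Enumeration P a → Enumeration Q b → (∀ {z} → P z → ¬ Q z) →
  Enumeration (P ∪ Q) (a + b)
enumeration-∪ {P = P} {Q = Q} (enumeration xs u s c refl) (enumeration ys u' s' c' refl) disjoint =
  enumeration (xs ++ ys) (Unique.++⁺ u u' λ (z∈xs , z∈ys) → disjoint (s z∈xs) (s' z∈ys))
    sound-++ complete-++ (length-++ xs)
  where
  sound-++ : ∀ {z} → z ∈ xs ++ ys → (P ∪ Q) z
  sound-++ z∈ with ∈-++⁻ xs z∈
  ... | inj₁ z∈xs = inj₁ (s z∈xs)
  ... | inj₂ z∈ys = inj₂ (s' z∈ys)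
  complete-++ : ∀ {z} → (P ∪ Q) z → z ∈ xs ++ ys
  complete-++ (inj₁ p) = ∈-++⁺ˡ (c p)
  complete-++ (inj₂ q) = ∈-++⁺ʳ xs (c' q)

enumeration-filter : (P? : Decidable P) (xs : List A) → Unique xs → (∀ z → z ∈ xs) →
  Enumeration P (length (filter P? xs))
enumeration-filter P? xs u all∈ =
  enumeration (filter P? xs) (Unique.filter⁺ P? {xs} u) (λ z∈ → proj₂ (∈-filter⁻ P? {xs = xs} z∈))
    (λ {z} p → ∈-filter⁺ P? (all∈ z) p) refl

enumeration-∃! : ∃! _≡_ P → Enumeration P 1
enumeration-∃! (x , p , unique) =
  enumeration (x ∷ []) ([] ∷ []) (λ { (here refl) → p }) (λ q → here (sym (unique q))) refl

enumeration-size≡1⇔∃! : Enumeration P k₁ → k₁ ≡ 1 ⇔ ∃! _≡_ P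
enumeration-size≡1⇔∃! en = mk⇔ (singleton en) (enumeration-size-unique en ∘ enumeration-∃!)
  where
  singleton : Enumeration P k₁ → k₁ ≡ 1 → ∃! _≡_ P
  singleton (enumeration (x ∷ []) _ s c refl) refl = x , s (here refl) , λ p → only (c p)
    where
    only : ∀ {y} → y ∈ x ∷ [] → x ≡ y
    only (here refl) = refl

enumeration-image : (f : A → B) → Injective _≡_ _≡_ f → Enumeration P k₁ →
  Enumeration (λ z → ∃[ a ] P a × z ≡ f a) k₁
enumeration-image f f-inj (enumeration xs u s c refl) =
  enumeration (map f xs) (Unique.map⁺ f-inj u)
    (λ z∈ → let (a , a∈ , z≡fa) = ∈-map⁻ f z∈ in a , s a∈ , z≡fa)
    (λ { (a , p , refl) → ∈-map⁺ f (c p) })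
    (length-map f xs)

∑< : ℕ → (ℕ → ℕ) → ℕ
∑< zero    F = 0
∑< (suc b) F = ∑< b F + F b

syntax ∑< b (λ k → e) = ∑[ k < b ] e

enumeration-⋃< : {Q : ℕ → A → Set} {F : ℕ → ℕ} (b : ℕ) →
  (∀ {k k′ z} → k < b → k′ < b → Q k z → Q k′ z → k ≡ k′) →
  (∀ {j} → j < b → Enumeration (Q j) (F j)) →
  Enumeration (λ z → ∃[ k ] k < b × Q k z) (∑[ k < b ] F k)
enumeration-⋃< zero    _        _  = enumeration-empty λ { _ (_ , () , _) }
enumeration-⋃< {Q = Q} (suc b) disjoint en =
  enumeration-resp split merge
    (enumeration-∪
      (enumeration-⋃< b (λ k<b k′<b → disjoint (m<n⇒m<1+n k<b) (m<n⇒m<1+n k′<b)) (λ k<b → en (m<n⇒m<1+n k<b)))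
      (en (n<1+n b))
      (λ (k , k<b , q) q′ → <-irrefl (disjoint (m<n⇒m<1+n k<b) (n<1+n b) q q′) k<b))
  where
  split : ∀ {z} → (∃[ k ] k < b × Q k z) ⊎ Q b z → ∃[ k ] k < suc b × Q k z
  split (inj₁ (k , k<b , q)) = k , m<n⇒m<1+n k<b , q
  split (inj₂ q)             = b , n<1+n b , q
  merge : ∀ {z} → ∃[ k ] k < suc b × Q k z → (∃[ k ] k < b × Q k z) ⊎ Q b z
  merge (k , s≤s k≤b , q) with m≤n⇒m<n∨m≡n k≤b
  ... | inj₁ k<b  = inj₁ (k , k<b , q)
  ... | inj₂ refl = inj₂ q

∃!-transfer : (f : A → B) → (∀ {a} → P a → Q (f a)) → (∀ {b} → Q b → ∃[ a ] P a × f a ≡ b) →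
  (∀ {a a′} → P a → P a′ → f a ≡ f a′ → a ≡ a′) → ∃! _≡_ P ⇔ ∃! _≡_ Q
∃!-transfer f P⇒Q Q⇒P f-injective = mk⇔
  (λ (a , p , unique) → f a , P⇒Q p , λ q →
    let (a′ , p′ , fa′≡b) = Q⇒P q in trans (cong f (unique p′)) fa′≡b)
  (λ (b , q , unique) → let (a , p , fa≡b) = Q⇒P q in
    a , p , λ p′ → f-injective p p′ (trans fa≡b (unique (P⇒Q p′))))

-- Involutions and the pattern 231

strictly-decreasing⇒≡∸ : ∀ {g : ℕ → ℕ} {c} → g 0 ≡ c →
  (∀ {p q} → p < q → q ≤ c → g q < g p) → ∀ {p} → p ≤ c → g p ≡ c ∸ p
strictly-decreasing⇒≡∸ {g} {c} g0≡c decreasing {p} p≤c =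
  ≤-antisym (m+n≤o⇒m≤o∸n (g p) (upper p≤c)) (lower (c ∸ p) (m+[n∸m]≡n p≤c))
  where
  upper : ∀ {p} → p ≤ c → g p + p ≤ c
  upper {zero}  _   = ≤-reflexive (trans (+-identityʳ (g 0)) g0≡c)
  upper {suc p} p<c = begin
    g (suc p) + suc p   ≡⟨ +-suc (g (suc p)) p ⟩
    suc (g (suc p) + p) ≤⟨ +-monoˡ-≤ p (decreasing (n<1+n p) p<c) ⟩
    g p + p             ≤⟨ upper (<⇒≤ p<c) ⟩
    c                   ∎
    where open ≤-Reasoning
  lower : ∀ d {p} → p + d ≡ c → d ≤ g p
  lower zero    _         = z≤n
  lower (suc d) {p} p+[1+d]≡c =
    ≤-trans (s≤s (lower d 1+p+d≡c)) (decreasing (n<1+n p) (subst (suc p ≤_) 1+p+d≡c (s≤s (m≤m+n p d))))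
    where 1+p+d≡c = trans (sym (+-suc p d)) p+[1+d]≡c

triple-injective : ∀ {a b c a′ b′ c′ : ℕ} →
  (a , b , c) ≡ (a′ , b′ , c′) → a ≡ a′ × b ≡ b′ × c ≡ c′
triple-injective refl = refl , refl , refl

record InvolutionOn (n : ℕ) (π : ℕ → ℕ) : Set where
  field
    maps-into  : ∀ {i} → i < n → π i < n
    involutive : ∀ {i} → i < n → π (π i) ≡ i

  injective : ∀ {i j} → i < n → j < n → π i ≡ π j → i ≡ j
  injective {i} {j} i<n j<n πi≡πj = begin
    i         ≡⟨ involutive i<n ⟨
    π (π i)   ≡⟨ cong π πi≡πj ⟩
    π (π j)   ≡⟨ involutive j<n ⟩
    j         ∎
    where open ≡-Reasoning

  complement-closed : ∀ {c} → (∀ {p} → p < c → π p < c) → ∀ {i} → c ≤ i → i < n → c ≤ π i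
  complement-closed {c} below c≤i i<n =
    ≮⇒≥ λ πi<c → <⇒≱ (subst (_< c) (involutive i<n) (below πi<c)) c≤i

Occurrence231 : ℕ → (ℕ → ℕ) → ℕ × ℕ × ℕ → Set
Occurrence231 n π (i , j , k) = i < j × j < k × k < n × π k < π i × π i < π j

Avoids231 : ℕ → (ℕ → ℕ) → Set
Avoids231 n π = ∀ t → ¬ Occurrence231 n π t

ContainsOnce231 : ℕ → (ℕ → ℕ) → Set
ContainsOnce231 n π = ∃! _≡_ (Occurrence231 n π)

module FirstBlock {n π} (inv : InvolutionOn n π) (0<n : 0 < n) where

  open InvolutionOn inv

  c : ℕ
  c = π 0

  c<n : c < n
  c<n = maps-into 0<n

  πc≡0 : π c ≡ 0
  πc≡0 = involutive 0<n

  π-positive : ∀ {r} → r < n → r ≢ c → 0 < π r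
  π-positive r<n r≢c = n≢0⇒n>0 λ πr≡0 → r≢c (trans (sym (involutive r<n)) (cong π πr≡0))

  ends-at-c : ∀ {p q} → p < q → q < c → π p < π q → Occurrence231 n π (p , q , c)
  ends-at-c p<q q<c πp<πq = p<q , q<c , c<n , πc<πp , πp<πq
    where
    πc<πp = subst (_< π _) (sym πc≡0) (π-positive (<-trans p<q (<-trans q<c c<n)) (<⇒≢ (<-trans p<q q<c)))

  descending-or-occurrence : ∀ {p q} → p < q → q ≤ c → π q < π p ⊎ Occurrence231 n π (p , q , c)
  descending-or-occurrence {p} {q} p<q q≤c with m≤n⇒m<n∨m≡n q≤c
  ... | inj₂ refl = inj₁ (subst (_< π p) (sym πc≡0) (π-positive (<-trans p<q c<n) (<⇒≢ p<q)))
  ... | inj₁ q<c with <-cmp (π p) (π q)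
  ...   | tri< πp<πq _ _ = inj₂ (ends-at-c p<q q<c πp<πq)
  ...   | tri≈ _ πp≡πq _ = ⊥-elim (<⇒≢ p<q (injective (<-trans p<q q<n) q<n πp≡πq))
    where q<n = <-trans q<c c<n
  ...   | tri> _ _ πq<πp = inj₁ πq<πp

  descending-first-block : (∀ {i j} → ¬ Occurrence231 n π (i , j , c)) →
    ∀ {p} → p ≤ c → π p ≡ c ∸ p
  descending-first-block none = strictly-decreasing⇒≡∸ refl λ p<q q≤c →
    [ id , ⊥-elim ∘ none ]′ (descending-or-occurrence p<q q≤c)

  -- Any way for the unique occurrence (i₀, j₀, c) to differ from (1, 2, 3) yields a second occurrence.
  module UniqueOccurrenceEndingAtC
    {i₀ j₀} (i₀<j₀ : i₀ < j₀) (j₀<c : j₀ < c) (πi₀<πj₀ : π i₀ < π j₀)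
    (unique : ∀ {t} → Occurrence231 n π t → (i₀ , j₀ , c) ≡ t) where

    same-first : ∀ {i j k} → Occurrence231 n π (i , j , k) → i₀ ≡ i
    same-first o = proj₁ (triple-injective (unique o))

    same-second : ∀ {i j k} → Occurrence231 n π (i , j , k) → j₀ ≡ j
    same-second o = proj₁ (proj₂ (triple-injective (unique o)))

    same-last : ∀ {i j k} → Occurrence231 n π (i , j , k) → c ≡ k
    same-last o = proj₂ (proj₂ (triple-injective (unique o)))

    j₀<n : j₀ < n
    j₀<n = <-trans j₀<c c<n

    i₀<n : i₀ < n
    i₀<n = <-trans i₀<j₀ j₀<n

    0<i₀ : 0 < i₀
    0<i₀ = n≢0⇒n>0 λ i₀≡0 → <⇒≢ (c<πj₀ i₀≡0) (same-last (occurrence i₀≡0))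
      where
      c<πj₀ : i₀ ≡ 0 → c < π j₀
      c<πj₀ i₀≡0 = subst (λ i → π i < π j₀) i₀≡0 πi₀<πj₀
      occurrence : i₀ ≡ 0 → Occurrence231 n π (0 , j₀ , π j₀)
      occurrence i₀≡0 = subst (_< j₀) i₀≡0 i₀<j₀ , <-trans j₀<c (c<πj₀ i₀≡0) , maps-into j₀<n ,
        subst (_< c) (sym (involutive j₀<n)) j₀<c , c<πj₀ i₀≡0

    below-c : ∀ {r} → 0 < r → r < c → π r < c
    below-c {r} 0<r r<c with <-cmp (π r) c
    ... | tri< πr<c _ _ = πr<c
    ... | tri≈ _ πr≡c _ = ⊥-elim (<⇒≢ 0<r (sym (injective (<-trans r<c c<n) 0<n πr≡c)))
    ... | tri> _ _ c<πr = ⊥-elim (<⇒≢ 0<i₀ (sym (same-first (ends-at-c 0<r r<c c<πr))))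

    mirrored-occurrence : Occurrence231 n π (π i₀ , π j₀ , c)
    mirrored-occurrence = ends-at-c πi₀<πj₀ (below-c (<-trans 0<i₀ i₀<j₀) j₀<c)
      (subst₂ _<_ (sym (involutive i₀<n)) (sym (involutive j₀<n)) i₀<j₀)

    πi₀≡i₀ : π i₀ ≡ i₀
    πi₀≡i₀ = sym (same-first mirrored-occurrence)

    πj₀≡j₀ : π j₀ ≡ j₀
    πj₀≡j₀ = sym (same-second mirrored-occurrence)

    i₀≡1 : i₀ ≡ 1
    i₀≡1 with <-cmp i₀ 1
    ... | tri< i₀<1 _ _ = ⊥-elim (<⇒≱ i₀<1 0<i₀)
    ... | tri≈ _ i₀≡1 _ = i₀≡1
    ... | tri> _ _ 1<i₀ with <-cmp (π 1) j₀
    ...   | tri< π1<j₀ _ _ = ⊥-elim (<⇒≢ 1<i₀ (sym (same-first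
              (ends-at-c 1<j₀ j₀<c (subst (π 1 <_) (sym πj₀≡j₀) π1<j₀)))))
      where 1<j₀ = <-trans 1<i₀ i₀<j₀
    ...   | tri≈ _ π1≡j₀ _ =
              ⊥-elim (<⇒≢ 1<j₀ (injective (<-trans 1<j₀ j₀<n) j₀<n (trans π1≡j₀ (sym πj₀≡j₀))))
      where 1<j₀ = <-trans 1<i₀ i₀<j₀
    ...   | tri> _ _ j₀<π1 = ⊥-elim (<⇒≢ π1<c (sym (same-last occurrence)))
      where
      1<n = <-trans 1<i₀ i₀<n
      π1<c : π 1 < c
      π1<c = below-c (s≤s z≤n) (<-trans (<-trans 1<i₀ i₀<j₀) j₀<c)
      occurrence : Occurrence231 n π (i₀ , j₀ , π 1)
      occurrence = i₀<j₀ , j₀<π1 , maps-into 1<n ,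
        subst₂ _<_ (sym (involutive 1<n)) (sym πi₀≡i₀) 1<i₀ , πi₀<πj₀

    π1≡1 : π 1 ≡ 1
    π1≡1 = subst (λ i → π i ≡ i) i₀≡1 πi₀≡i₀

    starts-at-1 : ∀ {r} → 1 < r → r < c → Occurrence231 n π (1 , r , c)
    starts-at-1 {r} 1<r r<c = ends-at-c 1<r r<c (subst (_< π r) (sym π1≡1) 1<πr)
      where
      r<n = <-trans r<c c<n
      1<πr : 1 < π r
      1<πr with π r in πr≡
      ... | zero        = ⊥-elim (<⇒≢ (π-positive r<n (<⇒≢ r<c)) (sym πr≡))
      ... | suc zero    = ⊥-elim (<⇒≢ 1<r (sym (injective r<n (<-trans 1<r r<n) (trans πr≡ (sym π1≡1)))))
      ... | suc (suc _) = s≤s (s≤s z≤n)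

    2<c : 2 < c
    2<c = ≤-<-trans (subst (_< j₀) i₀≡1 i₀<j₀) j₀<c

    j₀≡2 : j₀ ≡ 2
    j₀≡2 = same-second (starts-at-1 (s≤s (s≤s z≤n)) 2<c)

    c≡3 : c ≡ 3
    c≡3 with <-cmp c 3
    ... | tri< c<3 _ _ = ⊥-elim (<⇒≱ c<3 2<c)
    ... | tri≈ _ c≡3 _ = c≡3
    ... | tri> _ _ 3<c = ⊥-elim (<⇒≢ (s≤s (s≤s (s≤s z≤n)))
            (trans (sym j₀≡2) (same-second (starts-at-1 (s≤s (s≤s z≤n)) 3<c))))

    first-block-3120 : π 0 ≡ 3 × π 1 ≡ 1 × π 2 ≡ 2 × π 3 ≡ 0
    first-block-3120 =
      c≡3 , π1≡1 , subst (λ j → π j ≡ j) j₀≡2 πj₀≡j₀ , subst (λ k → π k ≡ 0) c≡3 πc≡0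

Occurrence312 : ℕ → (ℕ → ℕ) → ℕ × ℕ × ℕ → Set
Occurrence312 n π (i , j , k) = i < j × j < k × k < n × π j < π k × π k < π i

once-231⇔312 : ∀ {n π} → InvolutionOn n π → ContainsOnce231 n π ⇔ ∃! _≡_ (Occurrence312 n π)
once-231⇔312 {n} {π} inv = ∃!-transfer values to onto injective-on-occurrences
  where
  open InvolutionOn inv
  -- the values of a 231-occurrence in increasing order;
  -- as π = π⁻¹ they are the positions of a 312-occurrence
  values : ℕ × ℕ × ℕ → ℕ × ℕ × ℕ
  values (i , j , k) = π k , π i , π j
  to : ∀ {t} → Occurrence231 n π t → Occurrence312 n π (values t)
  to {i , j , k} (i<j , j<k , k<n , πk<πi , πi<πj) = πk<πi , πi<πj , maps-into j<n ,
    subst₂ _<_ (sym (involutive i<n)) (sym (involutive j<n)) i<j ,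
    subst₂ _<_ (sym (involutive j<n)) (sym (involutive k<n)) j<k
    where
    j<n = <-trans j<k k<n
    i<n = <-trans i<j j<n
  onto : ∀ {t} → Occurrence312 n π t → ∃[ s ] Occurrence231 n π s × values s ≡ t
  onto {a , b , c} (a<b , b<c , c<n , πb<πc , πc<πa) = (π b , π c , π a) ,
    (πb<πc , πc<πa , maps-into a<n ,
     subst₂ _<_ (sym (involutive a<n)) (sym (involutive b<n)) a<b ,
     subst₂ _<_ (sym (involutive b<n)) (sym (involutive c<n)) b<c) ,
    cong₂ _,_ (involutive a<n) (cong₂ _,_ (involutive b<n) (involutive c<n))
    where
    b<n = <-trans b<c c<n
    a<n = <-trans a<b b<n
  injective-on-occurrences : ∀ {t t′} → Occurrence231 n π t → Occurrence231 n π t′ →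
    values t ≡ values t′ → t ≡ t′
  injective-on-occurrences {i , j , k} {i′ , j′ , k′}
    (i<j , j<k , k<n , _) (i′<j′ , j′<k′ , k′<n , _) eq with triple-injective eq
  ... | πk≡ , πi≡ , πj≡ = cong₂ _,_ (injective (<-trans i<j j<n) (<-trans i′<j′ j′<n) πi≡)
                           (cong₂ _,_ (injective j<n j′<n πj≡) (injective k<n k′<n πk≡))
    where
    j<n = <-trans j<k k<n
    j′<n = <-trans j′<k′ k′<n

-- Lists and direct sums

-- junk value 0 beyond the end of the list
at : List ℕ → ℕ → ℕ
at []       _       = 0
at (x ∷ _)  zero    = x
at (_ ∷ xs) (suc i) = at xs i

at-++ˡ : ∀ xs ys {i} → i < length xs → at (xs ++ ys) i ≡ at xs i
at-++ˡ (x ∷ xs) ys {zero}  _         = refl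
at-++ˡ (x ∷ xs) ys {suc i} (s≤s i<) = at-++ˡ xs ys i<

at-++ʳ : ∀ xs ys i → at (xs ++ ys) (length xs + i) ≡ at ys i
at-++ʳ []       ys i = refl
at-++ʳ (x ∷ xs) ys i = at-++ʳ xs ys i

at-map : ∀ f xs {i} → i < length xs → at (map f xs) i ≡ f (at xs i)
at-map f (x ∷ xs) {zero}  _        = refl
at-map f (x ∷ xs) {suc i} (s≤s i<) = at-map f xs i<

at-drop : ∀ c xs i → at (drop c xs) i ≡ at xs (c + i)
at-drop zero    xs       i = refl
at-drop (suc c) []       i = refl
at-drop (suc c) (x ∷ xs) i = at-drop c xs i

at-downFrom : ∀ c {i} → i < c → at (downFrom c) i ≡ c ∸ suc i
at-downFrom (suc c) {zero}  _        = refl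
at-downFrom (suc c) {suc i} (s≤s i<) = at-downFrom c i<

at-extensionality : ∀ xs ys → length xs ≡ length ys →
  (∀ {i} → i < length xs → at xs i ≡ at ys i) → xs ≡ ys
at-extensionality []       []       _   _  = refl
at-extensionality (x ∷ xs) (y ∷ ys) len eq =
  cong₂ _∷_ (eq (s≤s z≤n)) (at-extensionality xs ys (suc-injective len) (eq ∘ s≤s))

below-or-shifted : ∀ c i → i < c ⊎ ∃[ i′ ] i ≡ c + i′
below-or-shifted c i with <-≤-connex i c
... | inj₁ i<c = inj₁ i<c
... | inj₂ c≤i = let (i′ , c+i′≡i) = m≤n⇒∃[o]m+o≡n c≤i in inj₂ (i′ , sym c+i′≡i)

infixr 5 _⊕_
_⊕_ : List ℕ → List ℕ → List ℕ
b ⊕ r = b ++ map (length b +_) r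

length-⊕ : ∀ b r → length (b ⊕ r) ≡ length b + length r
length-⊕ b r = trans (length-++ b) (cong (length b +_) (length-map _ r))

shift : ℕ → ℕ × ℕ × ℕ → ℕ × ℕ × ℕ
shift c (i , j , k) = c + i , c + j , c + k

shift-injective : ∀ c {t t′} → shift c t ≡ shift c t′ → t ≡ t′
shift-injective c {_ , _ , _} {_ , _ , _} eq with triple-injective eq
... | i≡ , j≡ , k≡ =
  cong₂ _,_ (+-cancelˡ-≡ c _ _ i≡) (cong₂ _,_ (+-cancelˡ-≡ c _ _ j≡) (+-cancelˡ-≡ c _ _ k≡))

module DirectSum (b r : List ℕ) where

  c m : ℕ
  c = length b
  m = length r

  σ : ℕ → ℕ
  σ = at (b ⊕ r)

  at-⊕ˡ : ∀ {i} → i < c → σ i ≡ at b i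
  at-⊕ˡ = at-++ˡ b _

  at-⊕ʳ : ∀ {i} → i < m → σ (c + i) ≡ c + at r i
  at-⊕ʳ {i} i<m = trans (at-++ʳ b _ i) (at-map (c +_) r i<m)

  involution-⊕ : InvolutionOn c (at b) → InvolutionOn m (at r) → InvolutionOn (c + m) σ
  involution-⊕ inv-b inv-r = record
    { maps-into  = λ i< → proj₁ (involutive-at i<)
    ; involutive = λ i< → proj₂ (involutive-at i<)
    }
    where
    open InvolutionOn
    involutive-at : ∀ {i} → i < c + m → σ i < c + m × σ (σ i) ≡ i
    involutive-at {i} i< with below-or-shifted c i
    ... | inj₁ i<c = subst (_< c + m) (sym (at-⊕ˡ i<c)) (<-≤-trans b-i<c (m≤m+n c m)) , (begin
      σ (σ i)        ≡⟨ cong σ (at-⊕ˡ i<c) ⟩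
      σ (at b i)     ≡⟨ at-⊕ˡ b-i<c ⟩
      at b (at b i)  ≡⟨ involutive inv-b i<c ⟩
      i              ∎)
      where
      open ≡-Reasoning
      b-i<c = maps-into inv-b i<c
    ... | inj₂ (i′ , refl) = subst (_< c + m) (sym (at-⊕ʳ i′<m)) (+-monoʳ-< c r-i′<m) , (begin
      σ (σ (c + i′))           ≡⟨ cong σ (at-⊕ʳ i′<m) ⟩
      σ (c + at r i′)          ≡⟨ at-⊕ʳ r-i′<m ⟩
      c + at r (at r i′)       ≡⟨ cong (c +_) (involutive inv-r i′<m) ⟩
      c + i′                   ∎)
      where
      open ≡-Reasoning
      i′<m = +-cancelˡ-< c i′ m i<
      r-i′<m = maps-into inv-r i′<m

  involution-⊕⁻ʳ : InvolutionOn (c + m) σ → InvolutionOn m (at r)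
  involution-⊕⁻ʳ inv = record { maps-into = r-i<m ; involutive = involutive-r }
    where
    open InvolutionOn inv
    r-i<m : ∀ {i} → i < m → at r i < m
    r-i<m i<m = +-cancelˡ-< c _ m (subst (_< c + m) (at-⊕ʳ i<m) (maps-into (+-monoʳ-< c i<m)))
    involutive-r : ∀ {i} → i < m → at r (at r i) ≡ i
    involutive-r {i} i<m = +-cancelˡ-≡ c _ _ (begin
      c + at r (at r i)   ≡⟨ at-⊕ʳ (r-i<m i<m) ⟨
      σ (c + at r i)      ≡⟨ cong σ (at-⊕ʳ i<m) ⟨
      σ (σ (c + i))       ≡⟨ involutive (+-monoʳ-< c i<m) ⟩
      c + i               ∎)
      where open ≡-Reasoning

  occurrence-⊕ˡ : ∀ {t} → Occurrence231 c (at b) t → Occurrence231 (c + m) σ t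
  occurrence-⊕ˡ {i , j , k} (i<j , j<k , k<c , bk<bi , bi<bj) =
    i<j , j<k , <-≤-trans k<c (m≤m+n c m) ,
    subst₂ _<_ (sym (at-⊕ˡ k<c)) (sym (at-⊕ˡ i<c)) bk<bi ,
    subst₂ _<_ (sym (at-⊕ˡ i<c)) (sym (at-⊕ˡ j<c)) bi<bj
    where
    j<c = <-trans j<k k<c
    i<c = <-trans i<j j<c

  occurrence-⊕ʳ : ∀ {t} → Occurrence231 m (at r) t → Occurrence231 (c + m) σ (shift c t)
  occurrence-⊕ʳ {i , j , k} (i<j , j<k , k<m , rk<ri , ri<rj) =
    +-monoʳ-< c i<j , +-monoʳ-< c j<k , +-monoʳ-< c k<m ,
    subst₂ _<_ (sym (at-⊕ʳ k<m)) (sym (at-⊕ʳ i<m)) (+-monoʳ-< c rk<ri) ,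
    subst₂ _<_ (sym (at-⊕ʳ i<m)) (sym (at-⊕ʳ j<m)) (+-monoʳ-< c ri<rj)
    where
    j<m = <-trans j<k k<m
    i<m = <-trans i<j j<m

  ShiftedOccurrence : ℕ × ℕ × ℕ → Set
  ShiftedOccurrence t = ∃[ t′ ] t ≡ shift c t′ × Occurrence231 m (at r) t′

  occurrence-⊕⁻ : (∀ {i} → i < c → at b i < c) → ∀ {t} → Occurrence231 (c + m) σ t →
    Occurrence231 c (at b) t ⊎ ShiftedOccurrence t
  occurrence-⊕⁻ b-into {i , j , k} (i<j , j<k , k< , σk<σi , σi<σj)
    with below-or-shifted c k | below-or-shifted c i
  ... | inj₁ k<c | _ = inj₁ (i<j , j<k , k<c ,
    subst₂ _<_ (at-⊕ˡ k<c) (at-⊕ˡ i<c) σk<σi , subst₂ _<_ (at-⊕ˡ i<c) (at-⊕ˡ j<c) σi<σj)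
    where
    j<c = <-trans j<k k<c
    i<c = <-trans i<j j<c
  ... | inj₂ (k′ , refl) | inj₁ i<c = ⊥-elim (<-asym σk<σi (begin-strict
    σ i            ≡⟨ at-⊕ˡ i<c ⟩
    at b i         <⟨ <-≤-trans (b-into i<c) (m≤m+n c _) ⟩
    c + at r k′    ≡⟨ at-⊕ʳ (+-cancelˡ-< c k′ m k<) ⟨
    σ (c + k′)     ∎))
    where open ≤-Reasoning
  ... | inj₂ (k′ , refl) | inj₂ (i′ , refl) with below-or-shifted c j
  ...   | inj₁ j<c         = ⊥-elim (<⇒≱ (<-trans i<j j<c) (m≤m+n c i′))
  ...   | inj₂ (j′ , refl) = inj₂ ((i′ , j′ , k′) , refl ,
    +-cancelˡ-< c i′ j′ i<j , +-cancelˡ-< c j′ k′ j<k , k′<m ,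
    +-cancelˡ-< c _ _ (subst₂ _<_ (at-⊕ʳ k′<m) (at-⊕ʳ i′<m) σk<σi) ,
    +-cancelˡ-< c _ _ (subst₂ _<_ (at-⊕ʳ i′<m) (at-⊕ʳ j′<m) σi<σj))
    where
    k′<m = +-cancelˡ-< c k′ m k<
    j′<m = <-trans (+-cancelˡ-< c j′ k′ j<k) k′<m
    i′<m = <-trans (+-cancelˡ-< c i′ j′ i<j) j′<m

  avoids-⊕⇔ : InvolutionOn c (at b) → Avoids231 c (at b) → Avoids231 (c + m) σ ⇔ Avoids231 m (at r)
  avoids-⊕⇔ inv-b avoids-b = mk⇔
    (λ avoids-σ t o → avoids-σ (shift c t) (occurrence-⊕ʳ o))
    (λ avoids-r t o → [ avoids-b t , (λ (t′ , _ , o′) → avoids-r t′ o′) ]′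
                        (occurrence-⊕⁻ (InvolutionOn.maps-into inv-b) o))

  once-⊕ʳ⇔ : InvolutionOn c (at b) → Avoids231 c (at b) →
    ContainsOnce231 (c + m) σ ⇔ ContainsOnce231 m (at r)
  once-⊕ʳ⇔ inv-b avoids-b = mk⇔ to from
    where
    split = occurrence-⊕⁻ (InvolutionOn.maps-into inv-b)
    to : ContainsOnce231 (c + m) σ → ContainsOnce231 m (at r)
    to (t , o , unique) with split o
    ... | inj₁ o-b = ⊥-elim (avoids-b t o-b)
    ... | inj₂ (t′ , refl , o′) = t′ , o′ , λ o″ → shift-injective c (unique (occurrence-⊕ʳ o″))
    from : ContainsOnce231 m (at r) → ContainsOnce231 (c + m) σ
    from (t′ , o′ , unique′) = shift c t′ , occurrence-⊕ʳ o′ , λ o →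
      [ (λ o-b → ⊥-elim (avoids-b _ o-b)) , (λ { (_ , refl , o″) → cong (shift c) (unique′ o″) }) ]′
        (split o)

  once-⊕ˡ⇔ : InvolutionOn c (at b) → ContainsOnce231 c (at b) →
    ContainsOnce231 (c + m) σ ⇔ Avoids231 m (at r)
  once-⊕ˡ⇔ inv-b ((i , j , k) , o-b@(i<j , j<k , k<c , _) , unique-b) = mk⇔ to from
    where
    to : ContainsOnce231 (c + m) σ → Avoids231 m (at r)
    to (t , o , unique) (i′ , j′ , k′) o′ = <⇒≱ (<-trans i<j (<-trans j<k k<c)) (begin
      c          ≤⟨ m≤m+n c i′ ⟩
      c + i′     ≡⟨ proj₁ (triple-injective shifted≡s) ⟩
      i          ∎)
      where
      open ≤-Reasoning
      shifted≡s = trans (sym (unique (occurrence-⊕ʳ o′))) (unique (occurrence-⊕ˡ o-b))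
    from : Avoids231 m (at r) → ContainsOnce231 (c + m) σ
    from avoids-r = (i , j , k) , occurrence-⊕ˡ o-b , λ o →
      [ unique-b , (λ (t′ , _ , o′) → ⊥-elim (avoids-r t′ o′)) ]′
        (occurrence-⊕⁻ (InvolutionOn.maps-into inv-b) o)

prefix-⊕-decomposition : ∀ {c} l b → length b ≡ c →
  InvolutionOn (length l) (at l) → InvolutionOn c (at b) → c ≤ length l →
  (∀ {p} → p < c → at l p ≡ at b p) → ∃[ r ] l ≡ b ⊕ r
prefix-⊕-decomposition l b refl inv-l inv-b c≤n l≡b = r , at-extensionality l (b ⊕ r) (sym length≡) at≡
  where
  open DirectSum b (map (_∸ length b) (drop (length b) l)) using (c; m; at-⊕ˡ; at-⊕ʳ)
  r = map (_∸ c) (drop c l)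
  m≡n∸c : m ≡ length l ∸ c
  m≡n∸c = trans (length-map _ (drop c l)) (length-drop c l)
  length≡ : length (b ⊕ r) ≡ length l
  length≡ = trans (length-⊕ b r) (trans (cong (c +_) m≡n∸c) (m+[n∸m]≡n c≤n))
  c≤at-l : ∀ {i} → c ≤ i → i < length l → c ≤ at l i
  c≤at-l = InvolutionOn.complement-closed inv-l
    (λ p<c → subst (_< c) (sym (l≡b p<c)) (InvolutionOn.maps-into inv-b p<c))
  at≡ : ∀ {i} → i < length l → at l i ≡ at (b ⊕ r) i
  at≡ {i} i<n with below-or-shifted c i
  ... | inj₁ i<c = trans (l≡b i<c) (sym (at-⊕ˡ i<c))
  ... | inj₂ (i′ , refl) = sym (begin
    at (b ⊕ r) (c + i′)          ≡⟨ at-⊕ʳ i′<m ⟩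
    c + at r i′                  ≡⟨ cong (c +_) (at-map (_∸ c) (drop c l) i′<length-drop) ⟩
    c + (at (drop c l) i′ ∸ c)   ≡⟨ cong (λ x → c + (x ∸ c)) (at-drop c l i′) ⟩
    c + (at l (c + i′) ∸ c)      ≡⟨ m+[n∸m]≡n (c≤at-l (m≤m+n c i′) i<n) ⟩
    at l (c + i′)                ∎)
    where
    open ≡-Reasoning
    i′<m : i′ < m
    i′<m = subst (i′ <_) (sym m≡n∸c) (subst (_< length l ∸ c) (m+n∸m≡n c i′) (∸-monoˡ-< i<n (m≤m+n c i′)))
    i′<length-drop : i′ < length (drop c l)
    i′<length-drop = subst (i′ <_) (length-map _ (drop c l)) i′<m

-- Decomposition by the first block

downFrom-involution : ∀ c → InvolutionOn c (at (downFrom c))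
downFrom-involution c = record
  { maps-into  = λ {i} i<c → subst (_< c) (sym (at-downFrom c i<c)) (∸-monoʳ-< (s≤s z≤n) i<c)
  ; involutive = involutive
  }
  where
  involutive : ∀ {i} → i < c → at (downFrom c) (at (downFrom c) i) ≡ i
  involutive {i} i<c = begin
    at (downFrom c) (at (downFrom c) i)   ≡⟨ cong (at (downFrom c)) (at-downFrom c i<c) ⟩
    at (downFrom c) (c ∸ suc i)           ≡⟨ at-downFrom c (∸-monoʳ-< (s≤s z≤n) i<c) ⟩
    c ∸ suc (c ∸ suc i)                   ≡⟨ cong (c ∸_) (+-∸-assoc 1 i<c) ⟨
    c ∸ (c ∸ i)                           ≡⟨ m∸[m∸n]≡n (<⇒≤ i<c) ⟩
    i                                     ∎
    where open ≡-Reasoning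

downFrom-avoids : ∀ c → Avoids231 c (at (downFrom c))
downFrom-avoids c (i , j , k) (i<j , j<k , k<c , _ , πi<πj) =
  <-asym πi<πj (subst₂ _<_ (sym (at-downFrom c j<c)) (sym (at-downFrom c i<c)) (∸-monoʳ-< (s≤s i<j) j<c))
  where
  j<c = <-trans j<k k<c
  i<c = <-trans i<j j<c

block3120 : List ℕ
block3120 = 3 ∷ 1 ∷ 2 ∷ 0 ∷ []

at-block3120-≤3 : ∀ i → at block3120 i ≤ 3
at-block3120-≤3 0                            = ≤-refl
at-block3120-≤3 1                            = s≤s z≤n
at-block3120-≤3 2                            = s≤s (s≤s z≤n)
at-block3120-≤3 3                            = z≤n
at-block3120-≤3 (suc (suc (suc (suc _)))) = z≤n

block3120-involution : InvolutionOn 4 (at block3120)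
block3120-involution = record { maps-into = λ {i} _ → s≤s (at-block3120-≤3 i) ; involutive = involutive }
  where
  involutive : ∀ {i} → i < 4 → at block3120 (at block3120 i) ≡ i
  involutive {0} _ = refl
  involutive {1} _ = refl
  involutive {2} _ = refl
  involutive {3} _ = refl
  involutive {suc (suc (suc (suc _)))} (s≤s (s≤s (s≤s (s≤s ()))))

-- position 0 holds the maximum 3, so an occurrence starts at i ≥ 1, and i < j < k < 4 forces (1, 2, 3)
block3120-contains-once : ContainsOnce231 4 (at block3120)
block3120-contains-once = (1 , 2 , 3) , occurrence , forced
  where
  occurrence : Occurrence231 4 (at block3120) (1 , 2 , 3)
  occurrence = s≤s (s≤s z≤n) , s≤s (s≤s (s≤s z≤n)) , ≤-refl , s≤s z≤n , s≤s (s≤s z≤n)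
  forced : ∀ {t} → Occurrence231 4 (at block3120) t → (1 , 2 , 3) ≡ t
  forced {i , j , k} (i<j , j<k , k<4 , _ , πi<πj) = cong₂ _,_ (sym i≡1) (cong₂ _,_ (sym j≡2) (sym k≡3))
    where
    0<i : 0 < i
    0<i = n≢0⇒n>0 λ { refl → <⇒≱ πi<πj (at-block3120-≤3 j) }
    1<j : 1 < j
    1<j = ≤-trans (s≤s 0<i) i<j
    k≡3 : k ≡ 3
    k≡3 = ≤-antisym (≤-pred k<4) (≤-trans (s≤s 1<j) j<k)
    j≡2 : j ≡ 2
    j≡2 = ≤-antisym (≤-pred (subst (j <_) k≡3 j<k)) 1<j
    i≡1 : i ≡ 1
    i≡1 = ≤-antisym (≤-pred (subst (i <_) j≡2 i<j)) 0<i

InvolutionWith : (ℕ → (ℕ → ℕ) → Set) → ℕ → List ℕ → Set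
InvolutionWith P n l = length l ≡ n × InvolutionOn n (at l) × P n (at l)

AvoidingInvolution OnceInvolution : ℕ → List ℕ → Set
AvoidingInvolution = InvolutionWith Avoids231
OnceInvolution     = InvolutionWith ContainsOnce231

PrefixInvariant : (ℕ → (ℕ → ℕ) → Set) → Set
PrefixInvariant P = ∀ {c} b r → length b ≡ c → InvolutionOn c (at b) → Avoids231 c (at b) →
  P (c + length r) (at (b ⊕ r)) ⇔ P (length r) (at r)

avoids-prefix-invariant : PrefixInvariant Avoids231
avoids-prefix-invariant b r refl = DirectSum.avoids-⊕⇔ b r

once-prefix-invariant : PrefixInvariant ContainsOnce231
once-prefix-invariant b r refl = DirectSum.once-⊕ʳ⇔ b r

involutionWith-⊕⇔ : ∀ {P Q c k n} b r → length b ≡ c → c + k ≡ n → InvolutionOn c (at b) →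
  (P (c + length r) (at (b ⊕ r)) ⇔ Q (length r) (at r)) → InvolutionWith P n (b ⊕ r) ⇔ InvolutionWith Q k r
involutionWith-⊕⇔ {P} {Q} b r refl refl inv-b P⇔Q = mk⇔ to from
  where
  open DirectSum b r using (involution-⊕; involution-⊕⁻ʳ)
  to : ∀ {k} → InvolutionWith P (length b + k) (b ⊕ r) → InvolutionWith Q k r
  to (len , inv , p) with +-cancelˡ-≡ (length b) _ _ (trans (sym (length-⊕ b r)) len)
  ... | refl = refl , involution-⊕⁻ʳ inv , Equivalence.to P⇔Q p
  from : ∀ {k} → InvolutionWith Q k r → InvolutionWith P (length b + k) (b ⊕ r)
  from (refl , inv-r , q) = length-⊕ b r , involution-⊕ inv-b inv-r , Equivalence.from P⇔Q q

DescendingThen : (ℕ → List ℕ → Set) → ℕ → ℕ → List ℕ → Set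
DescendingThen Q n k l = ∃[ r ] Q k r × l ≡ downFrom (n ∸ k) ⊕ r

Block3120Then : ℕ → List ℕ → Set
Block3120Then n l = 4 ≤ n × ∃[ r ] AvoidingInvolution (n ∸ 4) r × l ≡ block3120 ⊕ r

descending-⊕⇔ : ∀ {P} → PrefixInvariant P → ∀ {c k n} r → c + k ≡ n →
  InvolutionWith P n (downFrom c ⊕ r) ⇔ InvolutionWith P k r
descending-⊕⇔ {P} P-invariant {c} r c+k≡n =
  involutionWith-⊕⇔ {P} {P} (downFrom c) r (length-downFrom c) c+k≡n (downFrom-involution c)
    (P-invariant (downFrom c) r (length-downFrom c) (downFrom-involution c) (downFrom-avoids c))

descendingThen⇒involutionWith : ∀ {P n k l} → PrefixInvariant P → k < n →
  DescendingThen (InvolutionWith P) n k l → InvolutionWith P n l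
descendingThen⇒involutionWith {P} P-invariant k<n (r , w , refl) =
  Equivalence.from (descending-⊕⇔ {P} P-invariant r (m∸n+n≡m (<⇒≤ k<n))) w

block3120Then⇒once : ∀ {n l} → Block3120Then n l → OnceInvolution n l
block3120Then⇒once (4≤n , r , w , refl) = Equivalence.from
  (involutionWith-⊕⇔ {ContainsOnce231} {Avoids231} block3120 r refl (m+[n∸m]≡n 4≤n) block3120-involution
    (DirectSum.once-⊕ˡ⇔ block3120 r block3120-involution block3120-contains-once)) w

descending-block-split : ∀ {P n l} → PrefixInvariant P → 0 < n → InvolutionWith P n l →
  (∀ {i j} → ¬ Occurrence231 n (at l) (i , j , at l 0)) →
  ∃[ k ] k < n × DescendingThen (InvolutionWith P) n k l
descending-block-split {P} {l = l} P-invariant 0<n w@(refl , inv , _) none =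
  k , subst (k <_) c+k≡n (m<n+m k (s≤s z≤n)) , r ,
  Equivalence.to (descending-⊕⇔ {P} P-invariant r c+k≡n) (subst (InvolutionWith P _) l≡ w) ,
  subst (λ x → l ≡ downFrom x ⊕ r) (sym n∸k≡c) l≡
  where
  open FirstBlock inv 0<n using (c; c<n; descending-first-block)
  decomposition : ∃[ r ] l ≡ downFrom (suc c) ⊕ r
  decomposition = prefix-⊕-decomposition l (downFrom (suc c)) (length-downFrom (suc c)) inv
    (downFrom-involution (suc c)) c<n
    (λ p< → trans (descending-first-block none (≤-pred p<)) (sym (at-downFrom (suc c) p<)))
  r = proj₁ decomposition
  l≡ = proj₂ decomposition
  k = length r
  c+k≡n : suc c + k ≡ length l
  c+k≡n = sym (begin
    length l                          ≡⟨ cong length l≡ ⟩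
    length (downFrom (suc c) ⊕ r)     ≡⟨ length-⊕ (downFrom (suc c)) r ⟩
    length (downFrom (suc c)) + k     ≡⟨ cong (_+ k) (length-downFrom (suc c)) ⟩
    suc c + k                         ∎)
    where open ≡-Reasoning
  n∸k≡c : length l ∸ k ≡ suc c
  n∸k≡c = trans (cong (_∸ k) (sym c+k≡n)) (m+n∸n≡m (suc c) k)

block3120-split : ∀ {n l i₀ j₀} → 0 < n → OnceInvolution n l →
  Occurrence231 n (at l) (i₀ , j₀ , at l 0) → (∀ {t} → Occurrence231 n (at l) t → (i₀ , j₀ , at l 0) ≡ t) →
  Block3120Then n l
block3120-split {l = l} 0<n w@(refl , inv , _) (i₀<j₀ , j₀<c , _ , _ , πi₀<πj₀) unique =
  4≤n , r ,
  Equivalence.to (involutionWith-⊕⇔ {ContainsOnce231} {Avoids231} block3120 r refl (m+[n∸m]≡n 4≤n)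
    block3120-involution (DirectSum.once-⊕ˡ⇔ block3120 r block3120-involution block3120-contains-once))
    (subst (OnceInvolution _) l≡ w) ,
  l≡
  where
  open FirstBlock inv 0<n using (c<n)
  open FirstBlock.UniqueOccurrenceEndingAtC inv 0<n i₀<j₀ j₀<c πi₀<πj₀ unique
    using (first-block-3120)
  4≤n : 4 ≤ length l
  4≤n = subst (_< length l) (proj₁ first-block-3120) c<n
  agree : ∀ {p} → p < 4 → at l p ≡ at block3120 p
  agree {0} _ = proj₁ first-block-3120
  agree {1} _ = proj₁ (proj₂ first-block-3120)
  agree {2} _ = proj₁ (proj₂ (proj₂ first-block-3120))
  agree {3} _ = proj₂ (proj₂ (proj₂ first-block-3120))
  agree {suc (suc (suc (suc _)))} (s≤s (s≤s (s≤s (s≤s ()))))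
  decomposition : ∃[ r ] l ≡ block3120 ⊕ r
  decomposition = prefix-⊕-decomposition l block3120 refl inv block3120-involution 4≤n agree
  r = proj₁ decomposition
  l≡ = proj₂ decomposition

avoiding-decomposition : ∀ {n l} → 0 < n →
  AvoidingInvolution n l ⇔ (∃[ k ] k < n × DescendingThen AvoidingInvolution n k l)
avoiding-decomposition 0<n = mk⇔
  (λ w@(_ , _ , avoids) → descending-block-split {Avoids231} avoids-prefix-invariant 0<n w (avoids _))
  (λ (_ , k<n , d) → descendingThen⇒involutionWith {Avoids231} avoids-prefix-invariant k<n d)

once-decomposition : ∀ {n l} → 0 < n →
  OnceInvolution n l ⇔ ((∃[ k ] k < n × DescendingThen OnceInvolution n k l) ⊎ Block3120Then n l)
once-decomposition {n} {l} 0<n = mk⇔ to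
  [ (λ (_ , k<n , d) → descendingThen⇒involutionWith {ContainsOnce231} once-prefix-invariant k<n d)
  , block3120Then⇒once
  ]′
  where
  to : OnceInvolution n l → (∃[ k ] k < n × DescendingThen OnceInvolution n k l) ⊎ Block3120Then n l
  to w@(_ , _ , (_ , _ , k₀) , o , unique) with k₀ ≟ at l 0
  ... | no k₀≢c  = inj₁ (descending-block-split {ContainsOnce231} once-prefix-invariant 0<n w
                           (λ o′ → k₀≢c (proj₂ (proj₂ (triple-injective (unique o′))))))
  ... | yes refl = inj₂ (block3120-split 0<n w o unique)

-- Counting

avoidingCount : ℕ → ℕ
avoidingCount zero    = 1
avoidingCount (suc m) = 2 ^ m

block3120Count : ℕ → ℕ
block3120Count (suc (suc (suc (suc m)))) = avoidingCount m
block3120Count _                          = 0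

-- (m + 5) 2^m = (n - 1) 2^(n - 6) for n = m + 6
onceCount : ℕ → ℕ
onceCount (suc (suc (suc (suc (suc (suc m)))))) = (m + 5) * 2 ^ m
onceCount 5 = 2
onceCount 4 = 1
onceCount _ = 0

open +-*-Solver

avoidingCount-recurrence : ∀ m → ∑[ k < suc m ] avoidingCount k ≡ avoidingCount (suc m)
avoidingCount-recurrence zero    = refl
avoidingCount-recurrence (suc m) = begin
  ∑[ k < suc m ] avoidingCount k + 2 ^ m   ≡⟨ cong (_+ 2 ^ m) (avoidingCount-recurrence m) ⟩
  2 ^ m + 2 ^ m                            ≡⟨ solve 1 (λ x → x :+ x := con 2 :* x) refl (2 ^ m) ⟩
  2 ^ suc m                                ∎
  where open ≡-Reasoning

∑-onceCount : ∀ m → ∑[ k < 6 + m ] onceCount k ≡ (m + 3) * 2 ^ m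
∑-onceCount zero    = refl
∑-onceCount (suc m) = begin
  ∑[ k < 6 + m ] onceCount k + (m + 5) * 2 ^ m   ≡⟨ cong (_+ (m + 5) * 2 ^ m) (∑-onceCount m) ⟩
  (m + 3) * 2 ^ m + (m + 5) * 2 ^ m             ≡⟨ solve 2 (λ m x →
                                                     (m :+ con 3) :* x :+ (m :+ con 5) :* x
                                                     := (con 1 :+ m :+ con 3) :* (con 2 :* x)) refl m (2 ^ m) ⟩
  (suc m + 3) * 2 ^ suc m                       ∎
  where open ≡-Reasoning

onceCount-recurrence : ∀ n → 0 < n → ∑[ k < n ] onceCount k + block3120Count n ≡ onceCount n
onceCount-recurrence 1 _ = refl
onceCount-recurrence 2 _ = refl
onceCount-recurrence 3 _ = refl
onceCount-recurrence 4 _ = refl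
onceCount-recurrence 5 _ = refl
onceCount-recurrence (suc (suc (suc (suc (suc (suc m)))))) _ = begin
  ∑[ k < 6 + m ] onceCount k + 2 ^ suc m   ≡⟨ cong (_+ 2 ^ suc m) (∑-onceCount m) ⟩
  (m + 3) * 2 ^ m + 2 * 2 ^ m              ≡⟨ solve 2 (λ m x → (m :+ con 3) :* x :+ con 2 :* x
                                                         := (m :+ con 5) :* x) refl m (2 ^ m) ⟩
  (m + 5) * 2 ^ m                          ∎
  where open ≡-Reasoning

onceCount-closed-form : ∀ m → 2 * onceCount (5 + m) ≡ (4 + m) * 2 ^ m
onceCount-closed-form zero    = refl
onceCount-closed-form (suc m) =
  solve 2 (λ m x → con 2 :* ((m :+ con 5) :* x) := (con 5 :+ m) :* (con 2 :* x)) refl m (2 ^ m)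

⊕-injectiveʳ : ∀ b → Injective _≡_ _≡_ (b ⊕_)
⊕-injectiveʳ b eq = map-injective (+-cancelˡ-≡ (length b) _ _) (++-cancelˡ b _ _ eq)

descendingThen-enumeration : ∀ Q n k {F} → Enumeration (Q k) F → Enumeration (DescendingThen Q n k) F
descendingThen-enumeration Q n k = enumeration-image (downFrom (n ∸ k) ⊕_) (⊕-injectiveʳ _)

at-descending-⊕ : ∀ {n k} r → k < n → at (downFrom (n ∸ k) ⊕ r) 0 ≡ n ∸ suc k
at-descending-⊕ r k<n = cong (λ c → at (downFrom c ⊕ r) 0) (+-∸-assoc 1 k<n)

descendingThen-disjoint : ∀ Q {n k k′ l} → k < n → k′ < n →
  DescendingThen Q n k l → DescendingThen Q n k′ l → k ≡ k′
descendingThen-disjoint Q {n} {k} {k′} k<n k′<n (r , _ , refl) (r′ , _ , eq) =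
  suc-injective (∸-cancelˡ-≡ k<n k′<n (begin
    n ∸ suc k                          ≡⟨ at-descending-⊕ r k<n ⟨
    at (downFrom (n ∸ k) ⊕ r) 0        ≡⟨ cong (λ l → at l 0) eq ⟩
    at (downFrom (n ∸ k′) ⊕ r′) 0      ≡⟨ at-descending-⊕ r′ k′<n ⟩
    n ∸ suc k′                         ∎))
  where open ≡-Reasoning

descending≢block3120 : ∀ c r r′ → downFrom (suc c) ⊕ r ≢ block3120 ⊕ r′
descending≢block3120 c r r′ eq with cong (λ l → at l 0) eq
... | refl = 2≢1 (cong (λ l → at l 1) eq)
  where
  2≢1 : 2 ≢ 1
  2≢1 ()

empty-avoiding : ∃! _≡_ (AvoidingInvolution 0)
empty-avoiding =
  [] , (refl , record { maps-into = λ () ; involutive = λ () } , λ { _ (_ , _ , () , _) }) , λ { {[]} _ → refl }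

avoiding-enumeration : ∀ n → Enumeration (AvoidingInvolution n) (avoidingCount n)
avoiding-enumeration = <-rec _ λ where
  zero    _  → enumeration-∃! empty-avoiding
  (suc m) ih → subst (Enumeration _) (avoidingCount-recurrence m)
    (enumeration-resp (Equivalence.from (avoiding-decomposition (s≤s z≤n)))
                      (Equivalence.to (avoiding-decomposition (s≤s z≤n)))
      (enumeration-⋃< (suc m) (descendingThen-disjoint AvoidingInvolution)
        (λ {k} k<n → descendingThen-enumeration AvoidingInvolution (suc m) k (ih k<n))))

block3120Then-enumeration : ∀ n → Enumeration (Block3120Then n) (block3120Count n)
block3120Then-enumeration 0 = enumeration-empty λ { _ (() , _) }
block3120Then-enumeration 1 = enumeration-empty λ { _ (s≤s () , _) }
block3120Then-enumeration 2 = enumeration-empty λ { _ (s≤s (s≤s ()) , _) }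
block3120Then-enumeration 3 = enumeration-empty λ { _ (s≤s (s≤s (s≤s ())) , _) }
block3120Then-enumeration (suc (suc (suc (suc m)))) =
  enumeration-resp (λ d → s≤s (s≤s (s≤s (s≤s z≤n))) , d) proj₂
    (enumeration-image (block3120 ⊕_) (⊕-injectiveʳ block3120) (avoiding-enumeration m))

once-enumeration : ∀ n → Enumeration (OnceInvolution n) (onceCount n)
once-enumeration = <-rec _ λ where
  zero    _  → enumeration-empty λ { _ (_ , _ , _ , (_ , _ , () , _) , _) }
  (suc m) ih → subst (Enumeration _) (onceCount-recurrence (suc m) (s≤s z≤n))
    (enumeration-resp (Equivalence.from (once-decomposition (s≤s z≤n)))
                      (Equivalence.to (once-decomposition (s≤s z≤n)))
      (enumeration-∪
        (enumeration-⋃< (suc m) (descendingThen-disjoint OnceInvolution)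
          (λ {k} k<n → descendingThen-enumeration OnceInvolution (suc m) k (ih k<n)))
        (block3120Then-enumeration (suc m))
        λ { (k , k<n , r , _ , refl) (_ , r′ , _ , eq) →
          descending≢block3120 _ r r′ (trans (cong (λ c → downFrom c ⊕ r) (sym (+-∸-assoc 1 k<n))) eq) }))

-- Vectors over Fin

concatMap-unique : ∀ {A B : Set} {f : A → List B} (key : B → A) → (∀ {x y} → y ∈ f x → key y ≡ x) →
  (∀ x → Unique (f x)) → ∀ {xs} → Unique xs → Unique (concatMap f xs)
concatMap-unique {f = f} key key-f f-unique xs-unique = Unique.concat⁺
  (All.map⁺ (All.universal f-unique _))
  (AllPairs.map⁺ (AllPairs.map disjoint xs-unique))
  where
  disjoint : ∀ {x y} → x ≢ y → Disjoint (f x) (f y)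
  disjoint x≢y (z∈fx , z∈fy) = x≢y (trans (sym (key-f z∈fx)) (key-f z∈fy))

∈-concatMap⁺′ : ∀ {A B : Set} {f : A → List B} {x y xs} → x ∈ xs → y ∈ f x → y ∈ concatMap f xs
∈-concatMap⁺′ {f = f} x∈xs y∈fx = ∈-concatMap⁺ f (lose x∈xs y∈fx)

allVecs-unique : ∀ {A : Set} {xs : List A} → Unique xs → ∀ m → Unique (allVecs xs m)
allVecs-unique xs-unique zero    = [] ∷ []
allVecs-unique {xs = xs} xs-unique (suc m) = concatMap-unique head head-key
  (λ x → Unique.map⁺ ∷-injectiveʳ (allVecs-unique xs-unique m)) xs-unique
  where
  head-key : ∀ {x v} → v ∈ map (x ∷_) (allVecs xs m) → head v ≡ x
  head-key {x} v∈ with ∈-map⁻ (x ∷_) v∈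
  ... | _ , _ , refl = refl

allVecs-complete : ∀ {A : Set} {xs : List A} → (∀ x → x ∈ xs) → ∀ {m} (v : Vec A m) → v ∈ allVecs xs m
allVecs-complete all∈ []       = here refl
allVecs-complete all∈ (x ∷ v) = ∈-concatMap⁺′ (all∈ x) (∈-map⁺ (x ∷_) (allVecs-complete all∈ v))

triples-unique : ∀ n → Unique (triples n)
triples-unique n = concatMap-unique proj₁ first-key
  (λ i → concatMap-unique (proj₁ ∘ proj₂) (second-key i)
    (λ j → Unique.map⁺ (cong (proj₂ ∘ proj₂)) (Unique.allFin⁺ n)) (Unique.allFin⁺ n))
  (Unique.allFin⁺ n)
  where
  row : Fin n → Fin n → List (Fin n × Fin n × Fin n)
  row i j = map (λ k → (i , j , k)) (allFin n)
  second-key : ∀ i {j t} → t ∈ row i j → proj₁ (proj₂ t) ≡ j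
  second-key i {j} t∈ with ∈-map⁻ (λ k → (i , j , k)) t∈
  ... | _ , _ , refl = refl
  first-key : ∀ {i t} → t ∈ concatMap (row i) (allFin n) → proj₁ t ≡ i
  first-key {i} t∈ with find (∈-concatMap⁻ (row i) {xs = allFin n} t∈)
  ... | j , _ , t∈row with ∈-map⁻ (λ k → (i , j , k)) t∈row
  ...   | _ , _ , refl = refl

triples-complete : ∀ n t → t ∈ triples n
triples-complete n (i , j , k) =
  ∈-concatMap⁺′ (∈-allFin i) (∈-concatMap⁺′ (∈-allFin j) (∈-map⁺ _ (∈-allFin k)))

toNatList : ∀ {n m} → Vec (Fin n) m → List ℕ
toNatList []       = []
toNatList (x ∷ xs) = toℕ x ∷ toNatList xs

length-toNatList : ∀ {n m} (v : Vec (Fin n) m) → length (toNatList v) ≡ m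
length-toNatList []       = refl
length-toNatList (x ∷ xs) = cong suc (length-toNatList xs)

at-toNatList : ∀ {n m} (v : Vec (Fin n) m) i → at (toNatList v) (toℕ i) ≡ toℕ (lookup v i)
at-toNatList (x ∷ xs) zero    = refl
at-toNatList (x ∷ xs) (suc i) = at-toNatList xs i

toNatList-injective : ∀ {n m} → Injective _≡_ _≡_ (toNatList {n} {m})
toNatList-injective {x = []}     {[]}     _  = refl
toNatList-injective {x = x ∷ xs} {y ∷ ys} eq =
  cong₂ _∷_ (toℕ-injective (List.∷-injectiveˡ eq)) (toNatList-injective (List.∷-injectiveʳ eq))

module _ {n} (v : Vec (Fin n) n) where

  private
    π : ℕ → ℕ
    π = at (toNatList v)

  π-lookup : ∀ {i} (i<n : i < n) → π i ≡ toℕ (lookup v (fromℕ< i<n))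
  π-lookup i<n = trans (cong π (sym (toℕ-fromℕ< i<n))) (at-toNatList v (fromℕ< i<n))

  involution⇔ : IsInvolution v ⇔ InvolutionOn n π
  involution⇔ = mk⇔
    (λ inv → record
      { maps-into  = λ i<n → subst (_< n) (sym (π-lookup i<n)) (toℕ<n _)
      ; involutive = λ {i} i<n → begin
          π (π i)                                    ≡⟨ cong π (π-lookup i<n) ⟩
          π (toℕ (lookup v (fromℕ< i<n)))            ≡⟨ at-toNatList v _ ⟩
          toℕ (lookup v (lookup v (fromℕ< i<n)))     ≡⟨ cong toℕ (inv _) ⟩
          toℕ (fromℕ< i<n)                           ≡⟨ toℕ-fromℕ< i<n ⟩
          i                                          ∎
      })
    (λ inv i → toℕ-injective (begin
      toℕ (lookup v (lookup v i))   ≡⟨ at-toNatList v _ ⟨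
      π (toℕ (lookup v i))          ≡⟨ cong π (at-toNatList v i) ⟨
      π (π (toℕ i))                 ≡⟨ InvolutionOn.involutive inv (toℕ<n i) ⟩
      toℕ i                         ∎))
    where open ≡-Reasoning

toNatList-onto : ∀ {n} l → length l ≡ n → (∀ {i} → i < n → at l i < n) →
  Σ (Vec (Fin n) n) λ v → l ≡ toNatList v
toNatList-onto {n} l refl l<n = v , at-extensionality l (toNatList v) (sym (length-toNatList v)) at≡
  where
  v : Vec (Fin n) n
  v = tabulate (λ i → fromℕ< (l<n (toℕ<n i)))
  at≡ : ∀ {i} → i < n → at l i ≡ at (toNatList v) i
  at≡ {i} i<n = sym (begin
    at (toNatList v) i                              ≡⟨ π-lookup v i<n ⟩
    toℕ (lookup v (fromℕ< i<n))                     ≡⟨ cong toℕ (lookup∘tabulate _ (fromℕ< i<n)) ⟩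
    toℕ (fromℕ< (l<n (toℕ<n (fromℕ< i<n))))         ≡⟨ toℕ-fromℕ< _ ⟩
    at l (toℕ (fromℕ< i<n))                         ≡⟨ cong (at l) (toℕ-fromℕ< i<n) ⟩
    at l i                                          ∎)
    where open ≡-Reasoning

isYes-⇔ : ∀ {A B : Set} → A ⇔ B → (a? : Dec A) (b? : Dec B) → isYes a? ≡ isYes b?
isYes-⇔ A⇔B a? b? = trans (isYes≗does a?) (trans (does-⇔ A⇔B a? b?) (sym (isYes≗does b?)))

increasing₃ : ∀ {n} (φ : Fin 3 → Fin n) →
  φ zero <ᶠ φ (suc zero) → φ (suc zero) <ᶠ φ (suc (suc zero)) → ∀ {u v} → u <ᶠ v → φ u <ᶠ φ v
increasing₃ φ φ0<φ1 φ1<φ2 {zero}           {suc zero}       _ = φ0<φ1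
increasing₃ φ φ0<φ1 φ1<φ2 {zero}           {suc (suc zero)} _ = <-trans φ0<φ1 φ1<φ2
increasing₃ φ φ0<φ1 φ1<φ2 {suc zero}       {suc (suc zero)} _ = φ1<φ2
increasing₃ φ φ0<φ1 φ1<φ2 {_}              {zero}           ()
increasing₃ φ φ0<φ1 φ1<φ2 {suc zero}       {suc zero}       (s≤s ())
increasing₃ φ φ0<φ1 φ1<φ2 {suc (suc zero)} {suc zero}       (s≤s ())
increasing₃ φ φ0<φ1 φ1<φ2 {suc (suc zero)} {suc (suc zero)} (s≤s (s≤s ()))

orderIso-increasing : ∀ {n} (φ : Fin 3 → Fin n) → (∀ {u v} → u <ᶠ v → φ u <ᶠ φ v) →
  ∀ x α → (∀ a → lookup x a ≡ φ (lookup α a)) → OrderIso x α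
orderIso-increasing φ increasing x α x≡φα a b = begin
  isYes (lookup x a <? lookup x b)              ≡⟨ cong₂ (λ u v → isYes (u <? v)) (x≡φα a) (x≡φα b) ⟩
  isYes (φ (lookup α a) <? φ (lookup α b))      ≡⟨ isYes-⇔ (mk⇔ reflects increasing) _ _ ⟩
  isYes (lookup α a <? lookup α b)              ∎
  where
  open ≡-Reasoning
  reflects : ∀ {u v} → φ u <ᶠ φ v → u <ᶠ v
  reflects {u} {v} φu<φv with Fin.<-cmp u v
  ... | tri< u<v _ _ = u<v
  ... | tri≈ _ refl _ = ⊥-elim (Fin.<-irrefl refl φu<φv)
  ... | tri> _ _ v<u = ⊥-elim (Fin.<-asym φu<φv (increasing v<u))

orderIso-reflects : ∀ {n} (x : Vec (Fin n) 3) α → OrderIso x α → ∀ a b →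
  lookup α a <ᶠ lookup α b → lookup x a <ᶠ lookup x b
orderIso-reflects x α iso a b αa<αb = toWitness (subst T (sym (iso a b)) (fromWitness αa<αb))

orderIso-231⇔ : ∀ {n} (a b c : Fin n) → OrderIso (a ∷ b ∷ c ∷ []) p231 ⇔ (c <ᶠ a × a <ᶠ b)
orderIso-231⇔ a b c = mk⇔
  (λ iso → orderIso-reflects x p231 iso (suc (suc zero)) zero (s≤s z≤n) ,
           orderIso-reflects x p231 iso zero (suc zero) (s≤s (s≤s z≤n)))
  (λ (c<a , a<b) → orderIso-increasing (lookup (c ∷ a ∷ b ∷ [])) (increasing₃ _ c<a a<b) x p231
     λ { zero → refl ; (suc zero) → refl ; (suc (suc zero)) → refl })
  where x = a ∷ b ∷ c ∷ []

orderIso-312⇔ : ∀ {n} (a b c : Fin n) → OrderIso (a ∷ b ∷ c ∷ []) p312 ⇔ (b <ᶠ c × c <ᶠ a)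
orderIso-312⇔ a b c = mk⇔
  (λ iso → orderIso-reflects x p312 iso (suc zero) (suc (suc zero)) (s≤s z≤n) ,
           orderIso-reflects x p312 iso (suc (suc zero)) zero (s≤s (s≤s z≤n)))
  (λ (b<c , c<a) → orderIso-increasing (lookup (b ∷ c ∷ a ∷ [])) (increasing₃ _ b<c c<a) x p312
     λ { zero → refl ; (suc zero) → refl ; (suc (suc zero)) → refl })
  where x = a ∷ b ∷ c ∷ []

toℕ³ : ∀ {n} → Fin n × Fin n × Fin n → ℕ × ℕ × ℕ
toℕ³ (i , j , k) = toℕ i , toℕ j , toℕ k

∃!-toℕ³ : ∀ {n} {P : Fin n × Fin n × Fin n → Set} {Q : ℕ × ℕ × ℕ → Set} →
  (∀ {t} → P t ⇔ Q (toℕ³ t)) → (∀ {i j k} → Q (i , j , k) → i < n × j < n × k < n) →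
  ∃! _≡_ P ⇔ ∃! _≡_ Q
∃!-toℕ³ {n} {P} {Q} P⇔Q bounded = ∃!-transfer toℕ³ (Equivalence.to P⇔Q) onto (λ _ _ → toℕ³-injective)
  where
  toℕ³-injective : ∀ {t t′} → toℕ³ {n} t ≡ toℕ³ t′ → t ≡ t′
  toℕ³-injective {_ , _ , _} {_ , _ , _} eq with triple-injective eq
  ... | i≡ , j≡ , k≡ =
    cong₂ _,_ (toℕ-injective i≡) (cong₂ _,_ (toℕ-injective j≡) (toℕ-injective k≡))
  onto : ∀ {t} → Q t → ∃[ s ] P s × toℕ³ s ≡ t
  onto {i , j , k} q = s , Equivalence.from P⇔Q (subst Q (sym toℕ³s≡t) q) , toℕ³s≡t
    where
    s = let (i<n , j<n , k<n) = bounded q in fromℕ< i<n , fromℕ< j<n , fromℕ< k<n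
    toℕ³s≡t : toℕ³ s ≡ (i , j , k)
    toℕ³s≡t = cong₂ _,_ (toℕ-fromℕ< _) (cong₂ _,_ (toℕ-fromℕ< _) (toℕ-fromℕ< _))

module _ {n} (v : Vec (Fin n) n) where

  private
    at-v = at-toNatList v

  occurrence231⇔ : ∀ {t} → IsOccurrence v p231 t ⇔ Occurrence231 n (at (toNatList v)) (toℕ³ t)
  occurrence231⇔ {i , j , k} = mk⇔
    (λ (i<j , j<k , iso) → let (vk<vi , vi<vj) = Equivalence.to (orderIso-231⇔ _ _ _) iso in
      i<j , j<k , toℕ<n k , subst₂ _<_ (sym (at-v k)) (sym (at-v i)) vk<vi ,
                            subst₂ _<_ (sym (at-v i)) (sym (at-v j)) vi<vj)
    (λ (i<j , j<k , _ , πk<πi , πi<πj) → i<j , j<k , Equivalence.from (orderIso-231⇔ _ _ _)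
      (subst₂ _<_ (at-v k) (at-v i) πk<πi , subst₂ _<_ (at-v i) (at-v j) πi<πj))

  occurrence312⇔ : ∀ {t} → IsOccurrence v p312 t ⇔ Occurrence312 n (at (toNatList v)) (toℕ³ t)
  occurrence312⇔ {i , j , k} = mk⇔
    (λ (i<j , j<k , iso) → let (vj<vk , vk<vi) = Equivalence.to (orderIso-312⇔ _ _ _) iso in
      i<j , j<k , toℕ<n k , subst₂ _<_ (sym (at-v j)) (sym (at-v k)) vj<vk ,
                            subst₂ _<_ (sym (at-v k)) (sym (at-v i)) vk<vi)
    (λ (i<j , j<k , _ , πj<πk , πk<πi) → i<j , j<k , Equivalence.from (orderIso-312⇔ _ _ _)
      (subst₂ _<_ (at-v j) (at-v k) πj<πk , subst₂ _<_ (at-v k) (at-v i) πk<πi))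

ordered-bounded : ∀ {i j k n} → i < j → j < k → k < n → i < n × j < n × k < n
ordered-bounded i<j j<k k<n = <-trans i<j (<-trans j<k k<n) , <-trans j<k k<n , k<n

occurrences≡1⇔∃! : ∀ {n} (v : Vec (Fin n) n) α → occurrences v α ≡ 1 ⇔ ∃! _≡_ (IsOccurrence v α)
occurrences≡1⇔∃! {n} v α = enumeration-size≡1⇔∃!
  (enumeration-filter (isOccurrence? v α) (triples n) (triples-unique n) (triples-complete n))

containsOnce231⇔ : ∀ {n} (v : Vec (Fin n) n) →
  occurrences v p231 ≡ 1 ⇔ ContainsOnce231 n (at (toNatList v))
containsOnce231⇔ v = ⇔.trans (occurrences≡1⇔∃! v p231)
  (∃!-toℕ³ (occurrence231⇔ v) λ (i<j , j<k , k<n , _) → ordered-bounded i<j j<k k<n)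

containsOnce312⇔ : ∀ {n} (v : Vec (Fin n) n) → InvolutionOn n (at (toNatList v)) →
  occurrences v p312 ≡ 1 ⇔ ContainsOnce231 n (at (toNatList v))
containsOnce312⇔ v inv = ⇔.trans (occurrences≡1⇔∃! v p312) (⇔.trans
  (∃!-toℕ³ (occurrence312⇔ v) λ (i<j , j<k , k<n , _) → ordered-bounded i<j j<k k<n)
  (⇔.sym (once-231⇔312 inv)))

containingOnce⇔ : ∀ {n} α → α ≡ p231 ⊎ α ≡ p312 → (v : Vec (Fin n) n) →
  InvolutionContainingOnce α v ⇔ OnceInvolution n (toNatList v)
containingOnce⇔ {n} α α∈ v = mk⇔
  (λ (inv , once) → let inv′ = Equivalence.to (involution⇔ v) inv in
    length-toNatList v , inv′ , Equivalence.to (once⇔ α∈ inv′) once)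
  (λ (_ , inv , once) → Equivalence.from (involution⇔ v) inv , Equivalence.from (once⇔ α∈ inv) once)
  where
  once⇔ : α ≡ p231 ⊎ α ≡ p312 → InvolutionOn n (at (toNatList v)) →
    occurrences v α ≡ 1 ⇔ ContainsOnce231 n (at (toNatList v))
  once⇔ (inj₁ refl) _   = containsOnce231⇔ v
  once⇔ (inj₂ refl) inv = containsOnce312⇔ v inv

iInv≡onceCount : ∀ n α → α ≡ p231 ⊎ α ≡ p312 → iInv n α ≡ onceCount n
iInv≡onceCount n α α∈ = enumeration-size-unique
  (enumeration-resp
    (λ (v , ico , l≡v) →
      subst (OnceInvolution n) (sym l≡v) (Equivalence.to (containingOnce⇔ α α∈ v) ico))
    (λ {l} w@(length≡n , inv , _) →
      let (v , l≡v) = toNatList-onto l length≡n (InvolutionOn.maps-into inv) in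
      v , Equivalence.from (containingOnce⇔ α α∈ v) (subst (OnceInvolution n) l≡v w) , l≡v)
    (enumeration-image toNatList toNatList-injective
      (enumeration-filter (involutionContainingOnce? α) (allVecs (allFin n) n)
        (allVecs-unique (Unique.allFin⁺ n) n) (allVecs-complete ∈-allFin))))
  (once-enumeration n)

corollary3p6 : (n : ℕ) → 5 ≤ n → (α : Vec (Fin 3) 3) → (α ≡ p231 ⊎ α ≡ p312) →
    2 * iInv n α ≡ (n ∸ 1) * 2 ^ (n ∸ 5)
corollary3p6 n 5≤n α α∈ with m≤n⇒∃[o]m+o≡n 5≤n
... | m , refl = begin
  2 * iInv (5 + m) α       ≡⟨ cong (2 *_) (iInv≡onceCount (5 + m) α α∈) ⟩
  2 * onceCount (5 + m)    ≡⟨ onceCount-closed-form m ⟩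
  (4 + m) * 2 ^ m          ∎
  where open ≡-Reasoning
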